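{- Let $\ell,d\in\mathbb{N}$, $0<\beta'\le1/d$ and $\mu_4>0$. Then there exist $\beta>0$ and $n_0\in\mathbb{N}$ such that the following holds. Let $G$ be an oriented graph on $n\ge n_0$ vertices and let $\mathcal{P}=\{V_1,\dots,V_d\}$ be an $(H_4(G),\beta',\ell)$-closed partition of $V(G)$ such that $\mathbf{e}_i-\mathbf{e}_j$ is a $2$-transferral in $L^{\mu_4}_{\mathcal{P}}(H_4(G))$ for some distinct $i,j\in[d]$. Then the partition obtained from $\mathcal{P}$ by replacing $V_i$ and $V_j$ by $V_i\cup V_j$ is $(H_4(G),\beta,5\ell+1)$-closed.
   Context: An oriented graph is a loopless directed graph with at most one of $uv$, $vu$ per pair of distinct vertices. $D=D_{1,1,2}$ is the tournament on vertices $a,b,c_1,c_2$ with edges $ab,bc_1,bc_2,c_1a,c_2a,c_1c_2$; $H_4(G)$ is the $4$-uniform hypergraph on $V(G)$ whose edges are the $4$-sets $e$ such that $G[e]$ contains a copy of $D$. For a $k$-uniform hypergraph $H$ on $n$ vertices and $x,y\in V(H)$, a set $S\subseteq V(H)\setminus\{x,y\}$ with $|S|=k\ell-1$ is $(H,x,y)$-linking if $H[S\cup\{x\}]$ and $H[S\cup\{y\}]$ both have perfect matchings; $x,y$ are $(H,\beta,\ell)$-reachable if there are at least $\beta n^{k\ell-1}$ such sets; a set is $(H,\beta,\ell)$-closed if every pair of its distinct vertices is $(H,\beta,\ell)$-reachable; a partition is $(H,\beta,\ell)$-closed if each part is. For a partition $\mathcal{P}=(V_1,\dots,V_d)$ and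 $U\subseteq V(H)$, $\mathbf{i}_{\mathcal{P}}(U)=(|U\cap V_1|,\dots,|U\cap V_d|)$. $I^\mu_{\mathcal{P}}(H)$ is the set of vectors $\mathbf{v}$ such that at least $\mu n^k$ edges $e$ of $H$ have $\mathbf{i}_{\mathcal{P}}(e)=\mathbf{v}$, and $L^\mu_{\mathcal{P}}(H)$ is the additive subgroup of $\mathbb{Z}^d$ generated by $I^\mu_{\mathcal{P}}(H)$. $\mathbf{e}_i$ is the $i$-th unit vector. A $2$-transferral in $L^\mu_{\mathcal{P}}(H)$ is a vector $\mathbf{e}_i-\mathbf{e}_j$ ($i\ne j$) such that $\mathbf{e}_i-\mathbf{e}_j=\mathbf{v}_1-\mathbf{v}_2$ for some $\mathbf{v}_1,\mathbf{v}_2\in I^\mu_{\mathcal{P}}(H)$. -}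

module Defs where

open import Data.Nat as ℕ using (ℕ; _^_; _∸_)
open import Data.Integer as ℤ using (ℤ; +_)
open import Data.Rational as ℚ using (ℚ)
open import Data.Fin using (Fin; _≟_)
open import Data.Fin.Subset using (Subset; _∈_; _∉_; _⊆_; _∪_; _∩_; ⁅_⁆; ∣_∣)
open import Data.Vec using (tabulate)
open import Data.List using (List; length)
open import Data.List.Relation.Unary.All using (All)
open import Data.List.Relation.Unary.Any using (Any)
open import Data.List.Relation.Unary.AllPairs using (AllPairs)
open import Data.List.Relation.Unary.Unique.Propositional using (Unique)
open import Data.Product using (Σ; ∃; _×_; ∃-syntax)
open import Data.Bool using (Bool; if_then_else_)
open import Relation.Nullary using (¬_; does)
open import Relation.Binary.PropositionalEquality using (_≡_; _≢_)
open import Data.Empty using (⊥)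
open import Data.Fin.Subset using (Empty)

toℚ : ℕ → ℚ
toℚ m = (+ m) ℚ./ 1

record OrientedGraph (n : ℕ) : Set₁ where
  field
    Adj       : Fin n → Fin n → Set
    loopless  : ∀ u → ¬ Adj u u
    antisym   : ∀ u v → Adj u v → ¬ Adj v u
open OrientedGraph public

Hypergraph : ℕ → Set₁
Hypergraph n = Subset n → Set

IsD : ∀ {n} → OrientedGraph n → Fin n → Fin n → Fin n → Fin n → Set
IsD G a b c₁ c₂ =
  a ≢ b × a ≢ c₁ × a ≢ c₂ × b ≢ c₁ × b ≢ c₂ × c₁ ≢ c₂ ×
  Adj G a b × Adj G b c₁ × Adj G b c₂ × Adj G c₁ a × Adj G c₂ a × Adj G c₁ c₂

H₄ : ∀ {n} → OrientedGraph n → Hypergraph n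
H₄ G e = ∣ e ∣ ≡ 4 ×
  ∃[ a ] ∃[ b ] ∃[ c₁ ] ∃[ c₂ ]
    (a ∈ e × b ∈ e × c₁ ∈ e × c₂ ∈ e × IsD G a b c₁ c₂)

Disjoint : ∀ {n} → Subset n → Subset n → Set
Disjoint A B = Empty (A ∩ B)

HasPerfectMatching : ∀ {n} → Hypergraph n → Subset n → Set
HasPerfectMatching H T =
  ∃[ M ] (All H M × All (_⊆ T) M × AllPairs Disjoint M ×
          (∀ v → v ∈ T → Any (v ∈_) M))

Linking : ∀ {n} → ℕ → Hypergraph n → Fin n → Fin n → ℕ → Subset n → Set
Linking k H x y ℓ S =
  x ∉ S × y ∉ S × ∣ S ∣ ≡ k ℕ.* ℓ ∸ 1 ×
  HasPerfectMatching H (S ∪ ⁅ x ⁆) × HasPerfectMatching H (S ∪ ⁅ y ⁆)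

AtLeast : ∀ {n} → ℚ → (Subset n → Set) → Set
AtLeast q P = ∃[ L ] (Unique L × All P L × q ℚ.≤ toℚ (length L))

Reachable : ∀ {n} → ℕ → Hypergraph n → ℚ → ℕ → Fin n → Fin n → Set
Reachable {n} k H β ℓ x y =
  AtLeast (β ℚ.* toℚ (n ^ (k ℕ.* ℓ ∸ 1))) (Linking k H x y ℓ)

-- A partition (V_1,…,V_d) of Fin n is encoded by the map sending a vertex to the index of its part.
-- The partition is (H,β,ℓ)-closed if each part is (H,β,ℓ)-closed.
PartitionClosed : ∀ {n d} → ℕ → Hypergraph n → ℚ → ℕ → (Fin n → Fin d) → Set
PartitionClosed k H β ℓ P =
  ∀ x y → P x ≡ P y → x ≢ y → Reachable k H β ℓ x y

index : ∀ {n d} → (Fin n → Fin d) → Subset n → Fin d → ℕ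
index P U t = ∣ U ∩ tabulate (λ v → does (P v ≟ t)) ∣

InI : ∀ {n d} → ℕ → ℚ → (Fin n → Fin d) → Hypergraph n → (Fin d → ℕ) → Set
InI {n} k μ P H v =
  AtLeast (μ ℚ.* toℚ (n ^ k)) (λ e → H e × (∀ t → index P e t ≡ v t))

unit : ∀ {d} → Fin d → Fin d → ℤ
unit i t = if does (i ≟ t) then + 1 else + 0

Transferral : ∀ {n d} → ℕ → ℚ → (Fin n → Fin d) → Hypergraph n → Fin d → Fin d → Set
Transferral k μ P H i j =
  i ≢ j × ∃[ v₁ ] ∃[ v₂ ]
    (InI k μ P H v₁ × InI k μ P H v₂ ×
     (∀ t → unit i t ℤ.- unit j t ≡ (+ v₁ t) ℤ.- (+ v₂ t)))

-- partition obtained by replacing V_i and V_j by V_i ∪ V_j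
-- (vertices of V_j are relabelled i; the index j then labels an empty part)
merge : ∀ {n d} → (Fin n → Fin d) → Fin d → Fin d → Fin n → Fin d
merge P i j v = if does (P v ≟ j) then i else P v

{-# OPTIONS --safe #-}
-- Let x ≠ y lie in the merged part. Choose disjoint edges e₁, e₂ of H₄(G), avoiding x and y,
-- with index vectors v₁, v₂ such that e_(P x) + v₂ = e_(P y) + v₁: if P x = P y both come from
-- one family of μ₄ n⁴ edges, otherwise the transferral e_i − e_j = v₁ − v₂ supplies them, in the
-- order given by which of x, y lies in V_i. Then {x} ∪ e₂ and {y} ∪ e₁ have equal index vectors,
-- so their vertices pair up as (p_k , q_k), k = 1 … 5, with p_k and q_k in a common part of P.
-- By closedness each pair has β′ n^(4ℓ−1) linking sets; choosing S₁, …, S₅ in turn, disjoint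
-- from everything chosen before, S = e₁ ∪ e₂ ∪ S₁ ∪ … ∪ S₅ has 4(5ℓ+1) − 1 vertices, S ∪ {x} is
-- perfectly matched by e₁ and the S_k ∪ {p_k}, and S ∪ {y} by e₂ and the S_k ∪ {q_k}.
-- At each of the seven choices all but O(n^(t−1)) of the Ω(n^t) candidate t-sets avoid the O(1)
-- vertices used so far, and a union X ∪ Y arises from at most 2^|X ∪ Y| choices of X, so there
-- are Ω(n^|S|) distinct linking sets, with constants depending only on ℓ, β′ and μ₄.

module Submission where

-- A separate scope keeps the ℕ order used here apart from the ℚ order in the statement of lemma5p18.
module _ where

  import Algebra.Solver.IdempotentCommutativeMonoid as ∪-Solver
  open import Data.Bool using (true; false; if_then_else_)
  import Data.Bool.Properties as Bool
  open import Data.Fin using (Fin; zero; suc; _≟_)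
  import Data.Fin.Properties as Fin
  open import Data.Fin.Subset renaming (⊥ to ∅)
  open import Data.Fin.Subset.Properties
    using ( x≢y⇒x∉⁅y⁆; ⊆-antisym; drop-∷-⊆; p⊆q⇒∣p∣≤∣q∣; _⊆?_; _∈?_; nonempty?; Empty-unique; ∉⊥; ∣⊥∣≡0
          ; x∈⁅x⁆; x∈⁅y⁆⇒x≡y; ∣⁅x⁆∣≡1; x∈p∩q⁺; x∈p∩q⁻; x∈p∪q⁻; p⊆p∪q; q⊆p∪q
          ; ∪-identityˡ; ∪-identityʳ; ∪-idempotentCommutativeMonoid )
  open import Data.Integer as ℤ using (+[1+_]; -[1+_])
  import Data.Integer.Properties as ℤ
  import Data.Integer.Tactic.RingSolver as ℤ-Solver
  open import Data.List using (List; []; _∷_; _++_; length; filter; map; deduplicate)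
  open import Data.List.Properties using (map-∘; length-map; length-++; filter-++; filter-none)
  open import Data.List.Membership.Propositional using () renaming (_∈_ to _∈ₗ_)
  open import Data.List.Membership.Propositional.Properties using (∈-deduplicate⁺; ∈-map⁺)
  open import Data.List.Relation.Binary.Permutation.Propositional
    using (_↭_; prep; swap; ↭-refl; ↭-sym; ↭-trans; ↭⇒↭ₛ)
  import Data.List.Relation.Binary.Permutation.Propositional.Properties as ↭
  import Data.List.Relation.Binary.Permutation.Setoid.Properties as ↭ₛ
  open import Data.List.Relation.Binary.Sublist.Propositional.Properties as Sublist using (filter-⊆; length-mono-≤)
  open import Data.List.Relation.Unary.All as All using (All; []; _∷_)
  open import Data.List.Relation.Unary.All.Properties as All using (all-filter; filter⁺; ++⁺)
  open import Data.List.Relation.Unary.AllPairs using ([]; _∷_)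
  import Data.List.Relation.Unary.AllPairs.Properties as AllPairs
  open import Data.List.Relation.Unary.Any as Any using (Any)
  import Data.List.Relation.Unary.Any.Properties as Any
  open import Data.List.Relation.Unary.Unique.Propositional using (Unique)
  import Data.List.Relation.Unary.Unique.Propositional.Properties as Unique
  import Data.List.Relation.Unary.Unique.DecPropositional.Properties as DecUnique
  open import Data.Nat using (ℕ; zero; suc; _+_; _*_; _∸_; _^_; _≤_; z≤n; s≤s)
  open import Data.Nat.ListAction using (sum)
  open import Data.Nat.ListAction.Properties using (sum-↭)
  open import Data.Nat.Properties hiding (_≟_)
  open import Data.Nat.Tactic.RingSolver using (solve-∀)
  open import Data.Product using (_×_; _,_; proj₁; proj₂; map₂; ∃)
  open import Data.Rational as ℚ using (mkℚ; 0ℚ; toℚᵘ)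
  import Data.Rational.Properties as ℚ
  open import Data.Rational.Unnormalised as ℚᵘ using (mkℚᵘ)
  import Data.Rational.Unnormalised.Properties as ℚᵘ
  open import Data.Sum using (_⊎_; inj₁; inj₂; [_,_]′)
  open import Data.Vec using ([]; _∷_; here; tabulate)
  open import Data.Vec.Properties using (≡-dec)
  open import Function using (_∘_; case_of_)
  open import Relation.Binary using (DecidableEquality)
  open import Relation.Binary.PropositionalEquality
  open import Relation.Binary.PropositionalEquality.Properties using (setoid)
  open import Relation.Nullary using (¬_; yes; no; does; contradiction)
  open import Relation.Nullary.Decidable using (dec-true)
  open import Relation.Unary using (Decidable)
  open import Relation.Unary.Properties using (∁?)
  open import Defs
    using ( OrientedGraph; Hypergraph; H₄; Disjoint; HasPerfectMatching; Linking; AtLeast; toℚ; index; unit )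

  unique-constant-length≤1 : ∀ {A : Set} {a : A} {xs} → Unique xs → All (_≡ a) xs → length xs ≤ 1
  unique-constant-length≤1 [] [] = z≤n
  unique-constant-length≤1 (_ ∷ []) (_ ∷ []) = ≤-refl
  unique-constant-length≤1 ((x≢y ∷ _) ∷ _) (refl ∷ refl ∷ _) = contradiction refl x≢y

  module _ {A : Set} {P : A → Set} (P? : Decidable P) where

    length-filter+length-filter-∁ : ∀ xs → length (filter P? xs) + length (filter (∁? P?) xs) ≡ length xs
    length-filter+length-filter-∁ [] = refl
    length-filter+length-filter-∁ (x ∷ xs) with P? x
    ... | yes _ = cong suc (length-filter+length-filter-∁ xs)
    ... | no  _ = trans (+-suc _ _) (cong suc (length-filter+length-filter-∁ xs))

    length-filter-filter≤ : ∀ {Q : A → Set} (Q? : Decidable Q) xs → length (filter P? (filter Q? xs)) ≤ length (filter P? xs)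
    length-filter-filter≤ Q? xs = length-mono-≤ (Sublist.filter⁺ P? P? (λ { refl p → p }) (filter-⊆ Q? xs))

  module _ {A B : Set} {R : B → A → Set} (R? : ∀ b → Decidable (R b)) where

    union-bound : ∀ {K} bs xs → All (λ a → Any (λ b → R b a) bs) xs →
      All (λ b → length (filter (R? b) xs) ≤ K) bs → length xs ≤ length bs * K
    union-bound []       []      _            _                = z≤n
    union-bound []       (_ ∷ _) (() ∷ _)     _
    union-bound {K} (b ∷ bs) xs cover (b≤K ∷ bs≤K) = begin
        length xs                                     ≡⟨ sym (length-filter+length-filter-∁ (R? b) xs) ⟩
        length (filter (R? b) xs) + length rest       ≤⟨ +-mono-≤ b≤K (union-bound bs rest rest-covered rest≤K) ⟩
        K + length bs * K                             ∎
      where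
        open ≤-Reasoning
        rest : List A
        rest = filter (∁? (R? b)) xs
        rest-covered : All (λ a → Any (λ b → R b a) bs) rest
        rest-covered = All.zipWith (λ (¬Rb , any) → Any.tail ¬Rb any) (all-filter (∁? (R? b)) xs , filter⁺ (∁? (R? b)) cover)
        rest≤K : All (λ b → length (filter (R? b) rest) ≤ K) bs
        rest≤K = All.map (≤-trans (length-filter-filter≤ (R? _) (∁? (R? b)) xs)) bs≤K

  length≡0 : ∀ {A : Set} {P : A → Set} {xs} → (∀ {x} → ¬ P x) → All P xs → length xs ≡ 0
  length≡0 _ [] = refl
  length≡0 ¬P (p ∷ _) = contradiction p ¬P

  module _ {n : ℕ} {A B : Subset n} where

    disjoint⁺ : (∀ {v} → v ∈ A → v ∉ B) → Disjoint A B
    disjoint⁺ f (v , v∈A∩B) = let (v∈A , v∈B) = x∈p∩q⁻ A B v∈A∩B in f v∈A v∈B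

    disjoint⁻ : Disjoint A B → ∀ {v} → v ∈ A → v ∉ B
    disjoint⁻ d v∈A v∈B = d (_ , x∈p∩q⁺ (v∈A , v∈B))

  Disjoint-⊆ˡ : ∀ {n} {A B C : Subset n} → A ⊆ B → Disjoint B C → Disjoint A C
  Disjoint-⊆ˡ A⊆B B∩C=∅ = disjoint⁺ λ v∈A → disjoint⁻ B∩C=∅ (A⊆B v∈A)

  Disjoint-sym : ∀ {n} {A B : Subset n} → Disjoint A B → Disjoint B A
  Disjoint-sym A∩B=∅ = disjoint⁺ λ v∈B v∈A → disjoint⁻ A∩B=∅ v∈A v∈B

  Disjoint-∪ˡ : ∀ {n} {A B C : Subset n} → Disjoint A C → Disjoint B C → Disjoint (A ∪ B) C
  Disjoint-∪ˡ {A = A} {B} A∩C=∅ B∩C=∅ = disjoint⁺ λ v∈A∪B → [ disjoint⁻ A∩C=∅ , disjoint⁻ B∩C=∅ ]′ (x∈p∪q⁻ A B v∈A∪B)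

  Disjoint-∪ʳ : ∀ {n} {A B C : Subset n} → Disjoint A B → Disjoint A C → Disjoint A (B ∪ C)
  Disjoint-∪ʳ A∩B=∅ A∩C=∅ = Disjoint-sym (Disjoint-∪ˡ (Disjoint-sym A∩B=∅) (Disjoint-sym A∩C=∅))

  Disjoint-⊆ʳ : ∀ {n} {A B C : Subset n} → B ⊆ C → Disjoint A C → Disjoint A B
  Disjoint-⊆ʳ B⊆C A∩C=∅ = Disjoint-sym (Disjoint-⊆ˡ B⊆C (Disjoint-sym A∩C=∅))

  ∉-∪ : ∀ {n} {v : Fin n} {X Y} → v ∉ X → v ∉ Y → v ∉ X ∪ Y
  ∉-∪ {X = X} {Y} v∉X v∉Y v∈X∪Y = [ v∉X , v∉Y ]′ (x∈p∪q⁻ X Y v∈X∪Y)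

  x∉p⇒Disjoint⁅x⁆p : ∀ {n} {x : Fin n} {p} → x ∉ p → Disjoint ⁅ x ⁆ p
  x∉p⇒Disjoint⁅x⁆p {x = x} x∉p = disjoint⁺ λ v∈⁅x⁆ → subst (_∉ _) (sym (x∈⁅y⁆⇒x≡y x v∈⁅x⁆)) x∉p

  x∈p⇒⁅x⁆⊆p : ∀ {n} {x : Fin n} {p} → x ∈ p → ⁅ x ⁆ ⊆ p
  x∈p⇒⁅x⁆⊆p {x = x} x∈p y∈⁅x⁆ = subst (_∈ _) (sym (x∈⁅y⁆⇒x≡y x y∈⁅x⁆)) x∈p

  ∣p∪q∣+∣p∩q∣≡∣p∣+∣q∣ : ∀ {n} (p q : Subset n) → ∣ p ∪ q ∣ + ∣ p ∩ q ∣ ≡ ∣ p ∣ + ∣ q ∣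
  ∣p∪q∣+∣p∩q∣≡∣p∣+∣q∣ []            []            = refl
  ∣p∪q∣+∣p∩q∣≡∣p∣+∣q∣ (inside ∷ p)  (inside ∷ q)  =
    cong suc (trans (+-suc _ _) (trans (cong suc (∣p∪q∣+∣p∩q∣≡∣p∣+∣q∣ p q)) (sym (+-suc _ _))))
  ∣p∪q∣+∣p∩q∣≡∣p∣+∣q∣ (inside ∷ p)  (outside ∷ q) = cong suc (∣p∪q∣+∣p∩q∣≡∣p∣+∣q∣ p q)
  ∣p∪q∣+∣p∩q∣≡∣p∣+∣q∣ (outside ∷ p) (inside ∷ q)  = trans (cong suc (∣p∪q∣+∣p∩q∣≡∣p∣+∣q∣ p q)) (sym (+-suc _ _))
  ∣p∪q∣+∣p∩q∣≡∣p∣+∣q∣ (outside ∷ p) (outside ∷ q) = ∣p∪q∣+∣p∩q∣≡∣p∣+∣q∣ p q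

  ∣p∪q∣≤∣p∣+∣q∣ : ∀ {n} (p q : Subset n) → ∣ p ∪ q ∣ ≤ ∣ p ∣ + ∣ q ∣
  ∣p∪q∣≤∣p∣+∣q∣ p q = ≤-trans (m≤m+n _ _) (≤-reflexive (∣p∪q∣+∣p∩q∣≡∣p∣+∣q∣ p q))

  ∣p∪q∣≡∣p∣+∣q∣ : ∀ {n} {p q : Subset n} → Disjoint p q → ∣ p ∪ q ∣ ≡ ∣ p ∣ + ∣ q ∣
  ∣p∪q∣≡∣p∣+∣q∣ {n} {p} {q} d = begin
      ∣ p ∪ q ∣               ≡⟨ sym (+-identityʳ _) ⟩
      ∣ p ∪ q ∣ + 0           ≡⟨ cong (∣ p ∪ q ∣ +_) (sym (trans (cong ∣_∣ (Empty-unique d)) (∣⊥∣≡0 n))) ⟩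
      ∣ p ∪ q ∣ + ∣ p ∩ q ∣   ≡⟨ ∣p∪q∣+∣p∩q∣≡∣p∣+∣q∣ p q ⟩
      ∣ p ∣ + ∣ q ∣           ∎
    where open ≡-Reasoning

  ∪-cancelˡ : ∀ {n} {X Y Y′ : Subset n} → Disjoint X Y → Disjoint X Y′ → X ∪ Y ≡ X ∪ Y′ → Y ≡ Y′
  ∪-cancelˡ d d′ eq = ⊆-antisym (⊆-cancel d eq) (⊆-cancel d′ (sym eq))
    where
      ⊆-cancel : ∀ {X Y Y′ : Subset _} → Disjoint X Y → X ∪ Y ≡ X ∪ Y′ → Y ⊆ Y′
      ⊆-cancel {X} {Y} {Y′} d eq v∈Y with x∈p∪q⁻ X Y′ (subst (_ ∈_) eq (q⊆p∪q X Y v∈Y))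
      ... | inj₁ v∈X  = contradiction v∈Y (disjoint⁻ d v∈X)
      ... | inj₂ v∈Y′ = v∈Y′

  fromList : ∀ {n} → List (Fin n) → Subset n
  fromList []       = ∅
  fromList (v ∷ vs) = ⁅ v ⁆ ∪ fromList vs

  ∈-fromList⁺ : ∀ {n} {v : Fin n} {vs} → v ∈ₗ vs → v ∈ fromList vs
  ∈-fromList⁺ {vs = w ∷ vs} (Any.here refl) = p⊆p∪q (fromList vs) (x∈⁅x⁆ w)
  ∈-fromList⁺ {vs = w ∷ vs} (Any.there v∈vs) = q⊆p∪q ⁅ w ⁆ (fromList vs) (∈-fromList⁺ v∈vs)

  ∈-fromList⁻ : ∀ {n} {v : Fin n} {vs} → v ∈ fromList vs → v ∈ₗ vs
  ∈-fromList⁻ {vs = []} v∈∅ = contradiction v∈∅ ∉⊥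
  ∈-fromList⁻ {vs = w ∷ vs} v∈ with x∈p∪q⁻ ⁅ w ⁆ (fromList vs) v∈
  ... | inj₁ v∈⁅w⁆  = Any.here (x∈⁅y⁆⇒x≡y w v∈⁅w⁆)
  ... | inj₂ v∈vs   = Any.there (∈-fromList⁻ v∈vs)

  elements : ∀ {n} → Subset n → List (Fin n)
  elements []            = []
  elements (inside ∷ p)  = zero ∷ map suc (elements p)
  elements (outside ∷ p) = map suc (elements p)

  fromList-map-suc : ∀ {n} (vs : List (Fin n)) → fromList (map suc vs) ≡ outside ∷ fromList vs
  fromList-map-suc []       = refl
  fromList-map-suc (v ∷ vs) = cong (⁅ suc v ⁆ ∪_) (fromList-map-suc vs)

  fromList-elements : ∀ {n} (p : Subset n) → fromList (elements p) ≡ p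
  fromList-elements []            = refl
  fromList-elements (inside ∷ p)  =
    trans (cong (⁅ zero ⁆ ∪_) (fromList-map-suc (elements p))) (cong (inside ∷_) (trans (∪-identityˡ _) (fromList-elements p)))
  fromList-elements (outside ∷ p) = trans (fromList-map-suc (elements p)) (cong (outside ∷_) (fromList-elements p))

  elements-unique : ∀ {n} (p : Subset n) → Unique (elements p)
  elements-unique []            = []
  elements-unique (inside ∷ p)  = All.map⁺ (All.universal (λ _ ()) _) ∷ Unique.map⁺ Fin.suc-injective (elements-unique p)
  elements-unique (outside ∷ p) = Unique.map⁺ Fin.suc-injective (elements-unique p)

  length-elements : ∀ {n} (p : Subset n) → length (elements p) ≡ ∣ p ∣
  length-elements []            = refl
  length-elements (inside ∷ p)  = cong suc (trans (length-map suc (elements p)) (length-elements p))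
  length-elements (outside ∷ p) = trans (length-map suc (elements p)) (length-elements p)

  ∈-elements⁺ : ∀ {n} {v : Fin n} {p} → v ∈ p → v ∈ₗ elements p
  ∈-elements⁺ {p = p} v∈p = ∈-fromList⁻ (subst (_ ∈_) (sym (fromList-elements p)) v∈p)

  ∈-elements⁻ : ∀ {n} {v : Fin n} {p} → v ∈ₗ elements p → v ∈ p
  ∈-elements⁻ {p = p} v∈ = subst (_ ∈_) (fromList-elements p) (∈-fromList⁺ v∈)

  tailsWith : ∀ {n} → Side → List (Subset (suc n)) → List (Subset n)
  tailsWith _       []                   = []
  tailsWith inside  ((inside  ∷ p) ∷ ps) = p ∷ tailsWith inside ps
  tailsWith inside  ((outside ∷ _) ∷ ps) = tailsWith inside ps
  tailsWith outside ((inside  ∷ _) ∷ ps) = tailsWith outside ps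
  tailsWith outside ((outside ∷ p) ∷ ps) = p ∷ tailsWith outside ps

  length-tailsWith : ∀ {n} (ps : List (Subset (suc n))) →
    length ps ≡ length (tailsWith inside ps) + length (tailsWith outside ps)
  length-tailsWith []                   = refl
  length-tailsWith ((inside  ∷ _) ∷ ps) = cong suc (length-tailsWith ps)
  length-tailsWith ((outside ∷ _) ∷ ps) = trans (cong suc (length-tailsWith ps)) (sym (+-suc _ _))

  All-tailsWith : ∀ {n} {P : Subset (suc n) → Set} {Q : Subset n → Set} s →
    (∀ {p} → P (s ∷ p) → Q p) → ∀ {ps} → All P ps → All Q (tailsWith s ps)
  All-tailsWith _       f {[]}                 []         = []
  All-tailsWith inside  f {(inside  ∷ _) ∷ _}  (px ∷ pxs) = f px ∷ All-tailsWith inside f pxs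
  All-tailsWith inside  f {(outside ∷ _) ∷ _}  (_  ∷ pxs) = All-tailsWith inside f pxs
  All-tailsWith outside f {(inside  ∷ _) ∷ _}  (_  ∷ pxs) = All-tailsWith outside f pxs
  All-tailsWith outside f {(outside ∷ _) ∷ _}  (px ∷ pxs) = f px ∷ All-tailsWith outside f pxs

  Unique-tailsWith : ∀ {n} s {ps : List (Subset (suc n))} → Unique ps → Unique (tailsWith s ps)
  Unique-tailsWith _       {[]}                []          = []
  Unique-tailsWith inside  {(inside  ∷ _) ∷ _} (p∉ ∷ uniq) =
    All-tailsWith inside (_∘ cong (inside ∷_)) p∉ ∷ Unique-tailsWith inside uniq
  Unique-tailsWith inside  {(outside ∷ _) ∷ _} (_  ∷ uniq) = Unique-tailsWith inside uniq
  Unique-tailsWith outside {(inside  ∷ _) ∷ _} (_  ∷ uniq) = Unique-tailsWith outside uniq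
  Unique-tailsWith outside {(outside ∷ _) ∷ _} (p∉ ∷ uniq) =
    All-tailsWith outside (_∘ cong (outside ∷_)) p∉ ∷ Unique-tailsWith outside uniq

  unique-subsets₀-length≤1 : ∀ {ps : List (Subset 0)} → Unique ps → length ps ≤ 1
  unique-subsets₀-length≤1 uniq = unique-constant-length≤1 uniq (All.universal (λ { [] → refl }) _)

  supersets-length≤ : ∀ {n} (A : Subset n) t {ps} → Unique ps →
    All (λ X → A ⊆ X × ∣ X ∣ ≡ ∣ A ∣ + t) ps → length ps ≤ n ^ t
  supersets-length≤ [] zero    uniq _  = unique-subsets₀-length≤1 uniq
  supersets-length≤ [] (suc t) _    [] = z≤n
  supersets-length≤ [] (suc t) {[] ∷ _} _ ((_ , ()) ∷ _)
  supersets-length≤ {suc n} (inside ∷ A) t {ps} uniq sups = begin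
      length ps                                                     ≡⟨ length-tailsWith ps ⟩
      length (tailsWith inside ps) + length (tailsWith outside ps)  ≡⟨ cong (length (tailsWith inside ps) +_) no-outsides ⟩
      length (tailsWith inside ps) + 0                              ≡⟨ +-identityʳ _ ⟩
      length (tailsWith inside ps)                                  ≤⟨ supersets-length≤ A t (Unique-tailsWith inside uniq) insides ⟩
      n ^ t                                                         ≤⟨ ^-monoˡ-≤ t (n≤1+n n) ⟩
      suc n ^ t                                                     ∎
    where
      open ≤-Reasoning
      no-outsides : length (tailsWith outside ps) ≡ 0
      no-outsides = length≡0 (λ (A⊆X , _) → case A⊆X here of λ ()) (All-tailsWith outside (λ x → x) sups)
      insides : All (λ X → A ⊆ X × ∣ X ∣ ≡ ∣ A ∣ + t) (tailsWith inside ps)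
      insides = All-tailsWith inside (λ (A⊆X , size) → drop-∷-⊆ A⊆X , suc-injective size) sups
  supersets-length≤ {suc n} (outside ∷ A) t {ps} uniq sups = begin
      length ps                                                     ≡⟨ length-tailsWith ps ⟩
      length (tailsWith inside ps) + length (tailsWith outside ps)  ≤⟨ +-monoʳ-≤ _ outsides ⟩
      length (tailsWith inside ps) + n ^ t                          ≤⟨ with-insides t insides ⟩
      suc n ^ t                                                     ∎
    where
      open ≤-Reasoning
      outsides : length (tailsWith outside ps) ≤ n ^ t
      outsides = supersets-length≤ A t (Unique-tailsWith outside uniq)
                   (All-tailsWith outside (λ (A⊆X , size) → drop-∷-⊆ A⊆X , size) sups)
      insides : All (λ X → A ⊆ X × suc ∣ X ∣ ≡ ∣ A ∣ + t) (tailsWith inside ps)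
      insides = All-tailsWith inside (λ (A⊆X , size) → drop-∷-⊆ A⊆X , size) sups
      with-insides : ∀ t → All (λ X → A ⊆ X × suc ∣ X ∣ ≡ ∣ A ∣ + t) (tailsWith inside ps) →
        length (tailsWith inside ps) + n ^ t ≤ suc n ^ t
      with-insides zero    ins = ≤-reflexive (cong (_+ 1) (length≡0 too-large ins))
        where
          too-large : ∀ {X} → ¬ (A ⊆ X × suc ∣ X ∣ ≡ ∣ A ∣ + 0)
          too-large (A⊆X , size) = <-irrefl refl (≤-trans (≤-reflexive (trans size (+-identityʳ _))) (p⊆q⇒∣p∣≤∣q∣ A⊆X))
      with-insides (suc t) ins = begin
        length (tailsWith inside ps) + n ^ suc t  ≤⟨ +-monoˡ-≤ _ (supersets-length≤ A t (Unique-tailsWith inside uniq)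
                                                      (All.map (map₂ (λ size → suc-injective (trans size (+-suc _ _)))) ins)) ⟩
        n ^ t + n ^ suc t                          ≤⟨ *-monoʳ-≤ (suc n) (^-monoˡ-≤ t (n≤1+n n)) ⟩
        suc n ^ suc t                              ∎

  subsets-length≤ : ∀ {n} (U : Subset n) {ps} → Unique ps → All (_⊆ U) ps → length ps ≤ 2 ^ ∣ U ∣
  subsets-length≤ [] uniq _ = unique-subsets₀-length≤1 uniq
  subsets-length≤ (inside ∷ U) {ps} uniq subs = begin
      length ps                                                     ≡⟨ length-tailsWith ps ⟩
      length (tailsWith inside ps) + length (tailsWith outside ps)  ≤⟨ +-mono-≤ (tails inside) (tails outside) ⟩
      2 ^ ∣ U ∣ + 2 ^ ∣ U ∣                                         ≡⟨ cong (2 ^ ∣ U ∣ +_) (sym (+-identityʳ _)) ⟩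
      2 ^ suc ∣ U ∣                                                 ∎
    where
      open ≤-Reasoning
      tails : ∀ s → length (tailsWith s ps) ≤ 2 ^ ∣ U ∣
      tails s = subsets-length≤ U (Unique-tailsWith s uniq) (All-tailsWith s drop-∷-⊆ subs)
  subsets-length≤ (outside ∷ U) {ps} uniq subs = begin
      length ps                                                     ≡⟨ length-tailsWith ps ⟩
      length (tailsWith inside ps) + length (tailsWith outside ps)  ≡⟨ cong (_+ length (tailsWith outside ps)) no-insides ⟩
      length (tailsWith outside ps)                                 ≤⟨ subsets-length≤ U (Unique-tailsWith outside uniq) outsides ⟩
      2 ^ ∣ U ∣                                                     ∎
    where
      open ≤-Reasoning
      no-insides : length (tailsWith inside ps) ≡ 0
      no-insides = length≡0 (λ X⊆U → case X⊆U here of λ ()) (All-tailsWith inside (λ x → x) subs)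
      outsides : All (_⊆ U) (tailsWith outside ps)
      outsides = All-tailsWith outside drop-∷-⊆ subs

  module _ {A : Set} (_≟_ : DecidableEquality A) where

    length≤-deduplicate : ∀ {K} xs → All (λ x → length (filter (_≟ x) xs) ≤ K) xs →
      length xs ≤ length (deduplicate _≟_ xs) * K
    length≤-deduplicate xs mult =
      union-bound (λ b a → a ≟ b) (deduplicate _≟_ xs) xs (All.tabulate (∈-deduplicate⁺ _≟_)) (All.deduplicate⁺ _ mult)

  _≟ₛ_ : ∀ {n} → DecidableEquality (Subset n)
  _≟ₛ_ = ≡-dec Bool._≟_

  ≤-half : ∀ {N X Y} → N ≤ Y + X → 2 * Y ≤ N → N ≤ 2 * X
  ≤-half {N} {X} {Y} N≤Y+X 2Y≤N = +-cancelˡ-≤ N N (2 * X) (begin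
      N + N                ≤⟨ +-mono-≤ N≤Y+X N≤Y+X ⟩
      (Y + X) + (Y + X)    ≡⟨ regroup Y X ⟩
      2 * Y + 2 * X        ≤⟨ +-monoˡ-≤ (2 * X) 2Y≤N ⟩
      N + 2 * X            ∎)
    where
      open ≤-Reasoning
      regroup : ∀ Y X → (Y + X) + (Y + X) ≡ 2 * Y + 2 * X
      regroup = solve-∀

  record Dense {n} (D s : ℕ) (Φ : Subset n → Set) : Set where
    constructor dense
    field
      members : List (Subset n)
      unique  : Unique members
      valid   : All (λ X → ∣ X ∣ ≡ s × Φ X) members
      many    : n ^ s ≤ D * length members

  module _ {n : ℕ} where

    Dense-weaken : ∀ {D D′ s} {Φ : Subset n → Set} → D ≤ D′ → Dense D s Φ → Dense D′ s Φ
    Dense-weaken D≤D′ (dense R uniq valid many) = dense R uniq valid (≤-trans many (*-monoˡ-≤ (length R) D≤D′))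

    Dense-map : ∀ {D s} {Φ Ψ : Subset n → Set} → (∀ {X} → ∣ X ∣ ≡ s → Φ X → Ψ X) → Dense D s Φ → Dense D s Ψ
    Dense-map f (dense R uniq valid many) = dense R uniq (All.map (λ (size , φ) → size , f size φ) valid) many

    deduplicate-dense : ∀ {K s} {Φ : Subset n → Set} xs → All (λ X → ∣ X ∣ ≡ s × Φ X) xs →
      All (λ X → length (filter (_≟ₛ X) xs) ≤ K) xs →
      ∃ λ R → Unique R × All (λ X → ∣ X ∣ ≡ s × Φ X) R × length xs ≤ length R * K
    deduplicate-dense xs valid mult =
      deduplicate _≟ₛ_ xs , DecUnique.deduplicate-! _≟ₛ_ xs , All.deduplicate⁺ _ valid , length≤-deduplicate _≟ₛ_ xs mult

    ∪-map-unique : ∀ {X : Subset n} {Ys} → All (Disjoint X) Ys → Unique Ys → Unique (map (X ∪_) Ys)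
    ∪-map-unique []       []           = []
    ∪-map-unique (d ∷ ds) (Y∉ ∷ uniq) =
      All.map⁺ (All.zipWith (λ (d′ , Y≢Y′) eq → Y≢Y′ (∪-cancelˡ d d′ eq)) (ds , Y∉)) ∷ ∪-map-unique ds uniq

    multiplicity≤1 : ∀ {xs} (U : Subset n) → Unique xs → length (filter (_≟ₛ U) xs) ≤ 1
    multiplicity≤1 {xs} U uniq = unique-constant-length≤1 (Unique.filter⁺ (_≟ₛ U) uniq) (all-filter (_≟ₛ U) xs)

    ∪-map-multiplicity : ∀ (U X : Subset n) {Ys} Xs → All (Disjoint X) Ys → Unique Ys →
      length (filter (_≟ₛ U) (map (X ∪_) Ys)) + length (filter (_⊆? U) Xs) ≤ length (filter (_⊆? U) (X ∷ Xs))
    ∪-map-multiplicity U X {Ys} Xs disj uniq with X ⊆? U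
    ... | yes _    = +-monoˡ-≤ _ (multiplicity≤1 U (∪-map-unique disj uniq))
    ... | no  X⊈U  = ≤-reflexive (cong (λ xs → length xs + length (filter (_⊆? U) Xs)) (filter-none (_≟ₛ U) X∪Y≢U))
      where
        X∪Y≢U : All (λ Z → ¬ Z ≡ U) (map (X ∪_) Ys)
        X∪Y≢U = All.map⁺ (All.universal (λ Y X∪Y≡U → X⊈U (λ v∈X → subst (_ ∈_) X∪Y≡U (p⊆p∪q Y v∈X))) Ys)

    module Unions {b s t : ℕ} {Φ Φ′ : Subset n → Set}
      (pick : ∀ {X} → ∣ X ∣ ≡ s → Φ X → Dense b t (λ Y → Disjoint X Y × Φ′ (X ∪ Y))) where

      Valid : Subset n → Set
      Valid X = ∣ X ∣ ≡ s × Φ X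

      unions : ∀ Xs → All Valid Xs → List (Subset n)
      unions []       []                   = []
      unions (X ∷ Xs) ((size , φ) ∷ valid) = map (X ∪_) (Dense.members (pick size φ)) ++ unions Xs valid

      unions-valid : ∀ Xs valid → All (λ U → ∣ U ∣ ≡ s + t × Φ′ U) (unions Xs valid)
      unions-valid []       []                   = []
      unions-valid (X ∷ Xs) ((size , φ) ∷ valid) =
        ++⁺ (All.map⁺ (All.map (λ (sizeY , disj , φ′) → trans (∣p∪q∣≡∣p∣+∣q∣ disj) (cong₂ _+_ size sizeY) , φ′)
                               (Dense.valid (pick size φ))))
            (unions-valid Xs valid)

      unions-length : ∀ Xs valid → length Xs * n ^ t ≤ b * length (unions Xs valid)
      unions-length []       []                   = z≤n
      unions-length (X ∷ Xs) ((size , φ) ∷ valid) = begin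
          n ^ t + length Xs * n ^ t                  ≤⟨ +-mono-≤ (Dense.many (pick size φ)) (unions-length Xs valid) ⟩
          b * length F + b * length rest             ≡⟨ sym (*-distribˡ-+ b _ _) ⟩
          b * (length F + length rest)               ≡⟨ cong (λ k → b * (k + length rest)) (sym (length-map (X ∪_) F)) ⟩
          b * (length (map (X ∪_) F) + length rest)  ≡⟨ cong (b *_) (sym (length-++ (map (X ∪_) F))) ⟩
          b * length (map (X ∪_) F ++ rest)          ∎
        where
          open ≤-Reasoning
          F rest : List (Subset n)
          F = Dense.members (pick size φ)
          rest = unions Xs valid

      unions-multiplicity : ∀ U Xs valid → length (filter (_≟ₛ U) (unions Xs valid)) ≤ length (filter (_⊆? U) Xs)
      unions-multiplicity U []       []                   = z≤n
      unions-multiplicity U (X ∷ Xs) ((size , φ) ∷ valid) = begin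
          length (filter (_≟ₛ U) (map (X ∪_) F ++ rest))
            ≡⟨ cong length (filter-++ (_≟ₛ U) (map (X ∪_) F) rest) ⟩
          length (filter (_≟ₛ U) (map (X ∪_) F) ++ filter (_≟ₛ U) rest)
            ≡⟨ length-++ (filter (_≟ₛ U) (map (X ∪_) F)) ⟩
          length (filter (_≟ₛ U) (map (X ∪_) F)) + length (filter (_≟ₛ U) rest)
            ≤⟨ +-monoʳ-≤ _ (unions-multiplicity U Xs valid) ⟩
          length (filter (_≟ₛ U) (map (X ∪_) F)) + length (filter (_⊆? U) Xs)
            ≤⟨ ∪-map-multiplicity U X Xs (All.map (proj₁ ∘ proj₂) (Dense.valid (pick size φ))) (Dense.unique (pick size φ)) ⟩
          length (filter (_⊆? U) (X ∷ Xs))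
            ∎
        where
          open ≤-Reasoning
          F rest : List (Subset n)
          F = Dense.members (pick size φ)
          rest = unions Xs valid

    Dense-extend : ∀ {D b s t} {Φ Φ′ : Subset n → Set} → Dense D s Φ →
      (∀ {X} → ∣ X ∣ ≡ s → Φ X → Dense b t (λ Y → Disjoint X Y × Φ′ (X ∪ Y))) →
      Dense (b * 2 ^ (s + t) * D) (s + t) Φ′
    Dense-extend {D} {b} {s} {t} {Φ′ = Φ′} (dense R uniqR validR manyR) pick =
      let (R′ , uniqR′ , validR′ , L≤) = deduplicate-dense L (unions-valid R validR) multiplicity
      in dense R′ uniqR′ validR′ (many R′ L≤)
      where
        open Unions {Φ′ = Φ′} pick

        L : List (Subset n)
        L = unions R validR

        -- U arises at most once from each X ⊆ U in R
        multiplicity : All (λ U → length (filter (_≟ₛ U) L) ≤ 2 ^ (s + t)) L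
        multiplicity = All.map (λ {U} (size , _) → begin
            length (filter (_≟ₛ U) L)   ≤⟨ unions-multiplicity U R validR ⟩
            length (filter (_⊆? U) R)   ≤⟨ subsets-length≤ U (Unique.filter⁺ (_⊆? U) uniqR) (all-filter (_⊆? U) R) ⟩
            2 ^ ∣ U ∣                   ≡⟨ cong (2 ^_) size ⟩
            2 ^ (s + t)                 ∎) (unions-valid R validR)
          where open ≤-Reasoning

        many : ∀ R′ → length L ≤ length R′ * 2 ^ (s + t) → n ^ (s + t) ≤ b * 2 ^ (s + t) * D * length R′
        many R′ L≤ = begin
            n ^ (s + t)                          ≡⟨ ^-distribˡ-+-* n s t ⟩
            n ^ s * n ^ t                        ≤⟨ *-monoˡ-≤ (n ^ t) manyR ⟩
            D * length R * n ^ t                 ≡⟨ *-assoc D (length R) (n ^ t) ⟩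
            D * (length R * n ^ t)               ≤⟨ *-monoʳ-≤ D (unions-length R validR) ⟩
            D * (b * length L)                   ≤⟨ *-monoʳ-≤ D (*-monoʳ-≤ b L≤) ⟩
            D * (b * (length R′ * 2 ^ (s + t)))  ≡⟨ rearrange D b (length R′) (2 ^ (s + t)) ⟩
            b * 2 ^ (s + t) * D * length R′      ∎
          where
            open ≤-Reasoning
            rearrange : ∀ D b r K → D * (b * (r * K)) ≡ b * K * D * r
            rearrange = solve-∀

    meeting-length≤ : ∀ {t} (W : Subset n) {Ys} → Unique Ys → All (λ Y → ∣ Y ∣ ≡ suc t) Ys →
      All (λ Y → Nonempty (W ∩ Y)) Ys → length Ys ≤ ∣ W ∣ * n ^ t
    meeting-length≤ {t} W {Ys} uniq sizes meets = begin
        length Ys                     ≤⟨ union-bound (λ v → v ∈?_) (elements W) Ys covered (All.universal containing _) ⟩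
        length (elements W) * n ^ t   ≡⟨ cong (_* n ^ t) (length-elements W) ⟩
        ∣ W ∣ * n ^ t                 ∎
      where
        open ≤-Reasoning
        covered : All (λ Y → Any (_∈ Y) (elements W)) Ys
        covered = All.map (λ (v , v∈W∩Y) → let (v∈W , v∈Y) = x∈p∩q⁻ W _ v∈W∩Y in
                                            Any.map (λ { refl → v∈Y }) (∈-elements⁺ v∈W)) meets
        containing : ∀ v → length (filter (v ∈?_) Ys) ≤ n ^ t
        containing v = supersets-length≤ ⁅ v ⁆ t (Unique.filter⁺ (v ∈?_) uniq)
          (All.zipWith superset (all-filter (v ∈?_) Ys , filter⁺ (v ∈?_) sizes))
          where
            superset : ∀ {Y} → v ∈ Y × ∣ Y ∣ ≡ suc t → ⁅ v ⁆ ⊆ Y × ∣ Y ∣ ≡ ∣ ⁅ v ⁆ ∣ + t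
            superset (v∈Y , size) = x∈p⇒⁅x⁆⊆p v∈Y , trans size (cong (_+ t) (sym (∣⁅x⁆∣≡1 v)))

    -- At most w n ^ t ≤ n ^ suc t / (2 b) of the sets meet W, so at least half of the n ^ suc t / b sets avoid it.
    Dense-avoid : ∀ {b t w} {Q : Subset n → Set} (W : Subset n) → ∣ W ∣ ≤ w → 2 * b * w ≤ n →
      Dense b (suc t) Q → Dense (2 * b) (suc t) (λ Y → Disjoint W Y × Q Y)
    Dense-avoid {b} {t} {w} {Q} W ∣W∣≤w large (dense L uniq valid many) =
      dense F (Unique.filter⁺ (∁? meets?) uniq) F-valid F-many
      where
        meets? : Decidable (λ Y → Nonempty (W ∩ Y))
        meets? Y = nonempty? (W ∩ Y)

        F M : List (Subset n)
        F = filter (∁? meets?) L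
        M = filter meets? L

        F-valid : All (λ Y → ∣ Y ∣ ≡ suc t × Disjoint W Y × Q Y) F
        F-valid = All.zipWith (λ (disj , size , q) → size , disj , q) (all-filter (∁? meets?) L , filter⁺ (∁? meets?) valid)

        M-length : length M ≤ w * n ^ t
        M-length = ≤-trans
          (meeting-length≤ W (Unique.filter⁺ meets? uniq) (filter⁺ meets? (All.map proj₁ valid)) (all-filter meets? L))
                           (*-monoˡ-≤ (n ^ t) ∣W∣≤w)

        F-many : n ^ suc t ≤ 2 * b * length F
        F-many = ≤-trans (≤-half {X = b * length F} {Y = b * (w * n ^ t)} L-split M-small)
                         (≤-reflexive (sym (*-assoc 2 b (length F))))
          where
            open ≤-Reasoning
            L-split : n ^ suc t ≤ b * (w * n ^ t) + b * length F
            L-split = begin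
              n ^ suc t                        ≤⟨ many ⟩
              b * length L                     ≡⟨ cong (b *_) (sym (length-filter+length-filter-∁ meets? L)) ⟩
              b * (length M + length F)        ≤⟨ *-monoʳ-≤ b (+-monoˡ-≤ (length F) M-length) ⟩
              b * (w * n ^ t + length F)       ≡⟨ *-distribˡ-+ b _ _ ⟩
              b * (w * n ^ t) + b * length F   ∎
            M-small : 2 * (b * (w * n ^ t)) ≤ n ^ suc t
            M-small = begin
              2 * (b * (w * n ^ t))   ≡⟨ regroup b w (n ^ t) ⟩
              2 * b * w * n ^ t       ≤⟨ *-monoˡ-≤ (n ^ t) large ⟩
              n * n ^ t               ∎
              where
                regroup : ∀ b w N → 2 * (b * (w * N)) ≡ 2 * b * w * N
                regroup = solve-∀

  module Growth {n : ℕ} (A : Subset n) (q M : ℕ) (large : 2 * q * (M + ∣ A ∣) ≤ n) where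

    growth : ℕ
    growth = 2 * q * 2 ^ M

    step : ∀ {D s t} {Φ Φ′ : Subset n → Set} → s + suc t ≤ M → Dense D s Φ →
      (∀ {X} → ∣ X ∣ ≡ s → Φ X → Dense q (suc t) (λ Y → Disjoint (X ∪ A) Y → Φ′ (X ∪ Y))) →
      Dense (growth * D) (s + suc t) Φ′
    step {D} {s} {t} {Φ} {Φ′} s+t≤M R pick =
      Dense-weaken (*-monoˡ-≤ D (*-monoʳ-≤ (2 * q) (^-monoʳ-≤ 2 s+t≤M))) (Dense-extend R avoiding)
      where
        avoiding : ∀ {X} → ∣ X ∣ ≡ s → Φ X → Dense (2 * q) (suc t) (λ Y → Disjoint X Y × Φ′ (X ∪ Y))
        avoiding {X} size φ =
          Dense-map (λ _ (disj , φ′) → Disjoint-⊆ˡ (p⊆p∪q A) disj , φ′ disj) (Dense-avoid (X ∪ A) ∣X∪A∣≤ large (pick size φ))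
          where
            ∣X∪A∣≤ : ∣ X ∪ A ∣ ≤ M + ∣ A ∣
            ∣X∪A∣≤ = ≤-trans (∣p∪q∣≤∣p∣+∣q∣ X A)
                             (+-monoˡ-≤ ∣ A ∣ (≤-trans (≤-reflexive size) (≤-trans (m≤m+n s (suc t)) s+t≤M)))

  module _ {n : ℕ} (H : Hypergraph n) where

    open ∪-Solver (∪-idempotentCommutativeMonoid n) using (solve; _⊜_; _⊕_)

    pm-edge : ∀ {e} → H e → HasPerfectMatching H e
    pm-edge {e} h = e ∷ [] , h ∷ [] , (λ v∈e → v∈e) ∷ [] , [] ∷ [] , λ _ v∈e → Any.here v∈e

    pm-∪ : ∀ {A B} → HasPerfectMatching H A → HasPerfectMatching H B → Disjoint A B → HasPerfectMatching H (A ∪ B)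
    pm-∪ {A} {B} (M₁ , edges₁ , inside₁ , disj₁ , cover₁) (M₂ , edges₂ , inside₂ , disj₂ , cover₂) A∩B=∅ =
      M₁ ++ M₂ , ++⁺ edges₁ edges₂ , ++⁺ (All.map ⊆A∪B inside₁) (All.map ⊆A∪B′ inside₂) ,
      AllPairs.++⁺ disj₁ disj₂ (All.map apart-all inside₁) ,
      λ v v∈A∪B → [ (λ v∈A → Any.++⁺ˡ (cover₁ v v∈A)) , (λ v∈B → Any.++⁺ʳ M₁ (cover₂ v v∈B)) ]′ (x∈p∪q⁻ A B v∈A∪B)
      where
        ⊆A∪B : ∀ {e} → e ⊆ A → e ⊆ A ∪ B
        ⊆A∪B e⊆A v∈e = p⊆p∪q B (e⊆A v∈e)
        ⊆A∪B′ : ∀ {e} → e ⊆ B → e ⊆ A ∪ B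
        ⊆A∪B′ e⊆B v∈e = q⊆p∪q A B (e⊆B v∈e)
        apart : ∀ {e e′} → e ⊆ A → e′ ⊆ B → Disjoint e e′
        apart e⊆A e′⊆B = Disjoint-⊆ˡ e⊆A (Disjoint-⊆ʳ e′⊆B A∩B=∅)
        apart-all : ∀ {e} → e ⊆ A → All (Disjoint e) M₂
        apart-all e⊆A = All.map (apart e⊆A) inside₂

    MatchableWithout : Subset n → List (Fin n) → Set
    MatchableWithout T ds =
      Unique ds × ∃ λ W → HasPerfectMatching H W × Disjoint W (fromList ds) × W ∪ fromList ds ≡ T

    matchableWithout-settle : ∀ {T p ds Y} → MatchableWithout T (p ∷ ds) → Disjoint T Y →
      HasPerfectMatching H (Y ∪ ⁅ p ⁆) → MatchableWithout (T ∪ Y) ds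
    matchableWithout-settle {T} {p} {ds} {Y} (p∉ds ∷ uniq , W , pmW , W∩pD=∅ , W∪pD≡T) T∩Y=∅ pmYp =
      uniq , W ∪ (Y ∪ ⁅ p ⁆) , pm-∪ pmW pmYp W∩Yp=∅ , W′∩D=∅ , trans (regroup W Y ⁅ p ⁆ D) (cong (_∪ Y) W∪pD≡T)
      where
        D : Subset n
        D = fromList ds

        W∪pD⊆T : W ∪ (⁅ p ⁆ ∪ D) ⊆ T
        W∪pD⊆T = subst (_ ∈_) W∪pD≡T

        p∉D : p ∉ D
        p∉D p∈D = All.lookup p∉ds (∈-fromList⁻ p∈D) refl

        W∩Yp=∅ : Disjoint W (Y ∪ ⁅ p ⁆)
        W∩Yp=∅ = Disjoint-∪ʳ (Disjoint-⊆ˡ (W∪pD⊆T ∘ p⊆p∪q (⁅ p ⁆ ∪ D)) T∩Y=∅) (Disjoint-⊆ʳ (p⊆p∪q D) W∩pD=∅)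

        W′∩D=∅ : Disjoint (W ∪ (Y ∪ ⁅ p ⁆)) D
        W′∩D=∅ = Disjoint-∪ˡ (Disjoint-⊆ʳ (q⊆p∪q ⁅ p ⁆ D) W∩pD=∅)
                   (Disjoint-∪ˡ (Disjoint-sym (Disjoint-⊆ˡ (W∪pD⊆T ∘ q⊆p∪q W (⁅ p ⁆ ∪ D) ∘ q⊆p∪q ⁅ p ⁆ D) T∩Y=∅))
                                (x∉p⇒Disjoint⁅x⁆p p∉D))

        regroup : ∀ W Y S D → (W ∪ (Y ∪ S)) ∪ D ≡ (W ∪ (S ∪ D)) ∪ Y
        regroup = solve 4 (λ W Y S D → (W ⊕ (Y ⊕ S)) ⊕ D ⊜ (W ⊕ (S ⊕ D)) ⊕ Y) refl

    matchableWithout-[] : ∀ {T} → MatchableWithout T [] → HasPerfectMatching H T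
    matchableWithout-[] (_ , W , pmW , _ , W∪∅≡T) = subst (HasPerfectMatching H) (trans (sym (∪-identityʳ W)) W∪∅≡T) pmW

  Unique-↭ : ∀ {A : Set} {xs ys : List A} → xs ↭ ys → Unique xs → Unique ys
  Unique-↭ xs↭ys = ↭ₛ.Unique-resp-↭ (setoid _) (↭⇒↭ₛ xs↭ys)

  fromList-↭ : ∀ {n} {xs ys : List (Fin n)} → xs ↭ ys → fromList xs ≡ fromList ys
  fromList-↭ xs↭ys = ⊆-antisym (λ v∈ → ∈-fromList⁺ (↭.∈-resp-↭ xs↭ys (∈-fromList⁻ v∈)))
                               (λ v∈ → ∈-fromList⁺ (↭.∈-resp-↭ (↭-sym xs↭ys) (∈-fromList⁻ v∈)))

  δ : ∀ {d} → Fin d → Fin d → ℕ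
  δ s t = if does (s ≟ t) then 1 else 0

  δ-refl : ∀ {d} (s : Fin d) → δ s s ≡ 1
  δ-refl s = cong (if_then 1 else 0) (dec-true (s ≟ s) refl)

  labelCount : ∀ {n d} → (Fin n → Fin d) → Fin d → List (Fin n) → ℕ
  labelCount P t vs = sum (map (λ v → δ (P v) t) vs)

  ∣b∷p∣ : ∀ {n} b (p : Subset n) → ∣ b ∷ p ∣ ≡ (if b then 1 else 0) + ∣ p ∣
  ∣b∷p∣ true  _ = refl
  ∣b∷p∣ false _ = refl

  labelCount-map-suc : ∀ {n d} (P : Fin (suc n) → Fin d) t vs → labelCount (P ∘ suc) t vs ≡ labelCount P t (map suc vs)
  labelCount-map-suc P t vs = cong sum (map-∘ vs)

  index-elements : ∀ {n d} (P : Fin n → Fin d) e t → index P e t ≡ labelCount P t (elements e)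
  index-elements P []            t = refl
  index-elements P (inside ∷ e)  t = trans (∣b∷p∣ (does (P zero ≟ t)) (e ∩ tabulate (λ v → does (P (suc v) ≟ t))))
    (cong (δ (P zero) t +_) (trans (index-elements (P ∘ suc) e t) (labelCount-map-suc P t (elements e))))
  index-elements P (outside ∷ e) t = trans (index-elements (P ∘ suc) e t) (labelCount-map-suc P t (elements e))

  module _ {n d : ℕ} (P : Fin n → Fin d) where

    labelCount-↭ : ∀ t {xs ys} → xs ↭ ys → labelCount P t xs ≡ labelCount P t ys
    labelCount-↭ t xs↭ys = sum-↭ (↭.map⁺ _ xs↭ys)

    extract : ∀ t ys → 1 ≤ labelCount P t ys → ∃ λ y → ∃ λ ys′ → P y ≡ t × ys ↭ y ∷ ys′
    extract t (y ∷ ys) 1≤ with P y ≟ t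
    ... | yes Py≡t = y , ys , Py≡t , ↭-refl
    ... | no  Py≢t =
      let (z , zs , Pz≡t , ys↭) = extract t ys 1≤
      in z , y ∷ zs , Pz≡t , ↭-trans (prep y ys↭) (swap y z ↭-refl)

    pairUp : ∀ xs ys → (∀ t → labelCount P t xs ≡ labelCount P t ys) →
      ∃ λ pairs → map proj₁ pairs ≡ xs × map proj₂ pairs ↭ ys × All (λ (p , q) → P p ≡ P q) pairs
    pairUp []       []       _    = [] , refl , ↭-refl , []
    pairUp []       (y ∷ ys) same = contradiction (trans (same (P y)) (cong (_+ labelCount P (P y) ys) (δ-refl (P y)))) λ ()
    pairUp (x ∷ xs) ys       same =
      let (y , ys′ , Py≡Px , ys↭) = extract (P x) ys (subst (1 ≤_) (same (P x)) x-counted)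
          (pairs , firsts , seconds↭ , labels) = pairUp xs ys′ λ t → +-cancelˡ-≡ (δ (P x) t) _ _
            (trans (same t) (trans (labelCount-↭ t ys↭) (cong (λ s → δ s t + labelCount P t ys′) Py≡Px)))
      in (x , y) ∷ pairs , cong (x ∷_) firsts , ↭-trans (prep y seconds↭) (↭-sym ys↭) , sym Py≡Px ∷ labels
      where
        x-counted : 1 ≤ labelCount P (P x) (x ∷ xs)
        x-counted = subst (λ k → 1 ≤ k + labelCount P (P x) xs) (sym (δ-refl (P x))) (s≤s z≤n)

  toℚᵘ-toℚ : ∀ N → toℚᵘ (toℚ N) ℚᵘ.≃ mkℚᵘ (ℤ.+ N) 0
  toℚᵘ-toℚ N = ℚ.toℚᵘ-fromℚᵘ (mkℚᵘ (ℤ.+ N) 0)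

  module _ (a b N L : ℕ) where

    private
      numerators : (ℤ.+ a ℤ.* ℤ.+ N) ℤ.* ℤ.+ 1 ≡ ℤ.+ (a * N)
      numerators = trans (ℤ.*-identityʳ _) (sym (ℤ.pos-* a N))
      denominators : ℤ.+ L ℤ.* (ℤ.+ suc b ℤ.* ℤ.+ 1) ≡ ℤ.+ (L * suc b)
      denominators = trans (cong (ℤ.+ L ℤ.*_) (ℤ.*-identityʳ _)) (sym (ℤ.pos-* L (suc b)))

    scaled≤⇒ : mkℚᵘ (ℤ.+ a) b ℚᵘ.* mkℚᵘ (ℤ.+ N) 0 ℚᵘ.≤ mkℚᵘ (ℤ.+ L) 0 → a * N ≤ L * suc b
    scaled≤⇒ h = ℤ.drop‿+≤+ (subst₂ ℤ._≤_ numerators denominators (ℚᵘ.drop-*≤* h))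

    scaled≤⇐ : a * N ≤ L * suc b → mkℚᵘ (ℤ.+ a) b ℚᵘ.* mkℚᵘ (ℤ.+ N) 0 ℚᵘ.≤ mkℚᵘ (ℤ.+ L) 0
    scaled≤⇐ h = ℚᵘ.*≤* (subst₂ ℤ._≤_ (sym numerators) (sym denominators) (ℤ.+≤+ h))

  r*N≤L⇒N≤↧r*L : ∀ {r} → 0ℚ ℚ.< r → ∀ {N L} → r ℚ.* toℚ N ℚ.≤ toℚ L → N ≤ ℚ.↧ₙ r * L
  r*N≤L⇒N≤↧r*L {r@(mkℚ +[1+ p ] q _)} _ {N} {L} h = begin
      N            ≤⟨ m≤m+n N (p * N) ⟩
      suc p * N    ≤⟨ scaled≤⇒ (suc p) q N L h′ ⟩
      L * suc q    ≡⟨ *-comm L (suc q) ⟩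
      suc q * L    ∎
    where
      open ≤-Reasoning
      h′ : mkℚᵘ (ℤ.+ suc p) q ℚᵘ.* mkℚᵘ (ℤ.+ N) 0 ℚᵘ.≤ mkℚᵘ (ℤ.+ L) 0
      h′ = ℚᵘ.≤-respʳ-≃ (toℚᵘ-toℚ L) (ℚᵘ.≤-respˡ-≃ (ℚᵘ.*-congˡ {toℚᵘ r} (toℚᵘ-toℚ N))
             (ℚᵘ.≤-respˡ-≃ (ℚ.toℚᵘ-homo-* r (toℚ N)) (ℚ.toℚᵘ-mono-≤ h)))
  r*N≤L⇒N≤↧r*L {mkℚ (ℤ.+ zero) _ _} (ℚ.*<* (ℤ.+<+ ()))
  r*N≤L⇒N≤↧r*L {mkℚ -[1+ _ ] _ _} (ℚ.*<* ())

  N≤[1+K]*L⇒N/[1+K]≤L : ∀ K {N L} → N ≤ suc K * L → ((ℤ.+ 1) ℚ./ suc K) ℚ.* toℚ N ℚ.≤ toℚ L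
  N≤[1+K]*L⇒N/[1+K]≤L K {N} {L} h = ℚ.toℚᵘ-cancel-≤
    (ℚᵘ.≤-respˡ-≃ (ℚᵘ.≃-sym (ℚ.toℚᵘ-homo-* ((ℤ.+ 1) ℚ./ suc K) (toℚ N)))
    (ℚᵘ.≤-respˡ-≃ (ℚᵘ.*-cong (ℚᵘ.≃-sym (ℚ.toℚᵘ-fromℚᵘ (mkℚᵘ (ℤ.+ 1) K))) (ℚᵘ.≃-sym (toℚᵘ-toℚ N)))
    (ℚᵘ.≤-respʳ-≃ (ℚᵘ.≃-sym (toℚᵘ-toℚ L))
    (scaled≤⇐ 1 K N L (subst₂ _≤_ (sym (*-identityˡ N)) (*-comm (suc K) L) h)))))

  0<1/suc : ∀ K → 0ℚ ℚ.< (ℤ.+ 1) ℚ./ suc K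
  0<1/suc K = ℚ.positive⁻¹ _ {{ℚ.normalize-pos 1 (suc K)}}

  atLeast⇒dense : ∀ {n r s} {Φ : Subset n → Set} → 0ℚ ℚ.< r → AtLeast (r ℚ.* toℚ (n ^ s)) Φ →
    (∀ {X} → Φ X → ∣ X ∣ ≡ s) → Dense (ℚ.↧ₙ r) s Φ
  atLeast⇒dense 0<r (L , uniq , valid , bound) size =
    dense L uniq (All.map (λ φ → size φ , φ) valid) (r*N≤L⇒N≤↧r*L 0<r bound)

  dense⇒atLeast : ∀ {n K s} {Φ : Subset n → Set} → Dense K s Φ → AtLeast (((ℤ.+ 1) ℚ./ suc K) ℚ.* toℚ (n ^ s)) Φ
  dense⇒atLeast {K = K} (dense L uniq valid many) =
    L , uniq , All.map proj₂ valid , N≤[1+K]*L⇒N/[1+K]≤L K (≤-trans many (*-monoˡ-≤ (length L) (n≤1+n K)))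

  merge-cases : ∀ {n d} (P : Fin n → Fin d) {i j} x y →
    (if does (P x ≟ j) then i else P x) ≡ (if does (P y ≟ j) then i else P y) →
    P x ≡ P y ⊎ (P x ≡ i × P y ≡ j) ⊎ (P x ≡ j × P y ≡ i)
  merge-cases P {i} {j} x y merged with P x ≟ j | P y ≟ j
  ... | yes Px≡j | yes Py≡j = inj₁ (trans Px≡j (sym Py≡j))
  ... | yes Px≡j | no  _    = inj₂ (inj₂ (Px≡j , sym merged))
  ... | no  _    | yes Py≡j = inj₂ (inj₁ (merged , Py≡j))
  ... | no  _    | no  _    = inj₁ merged

  unit≡δ : ∀ {d} (i t : Fin d) → unit i t ≡ ℤ.+ δ i t
  unit≡δ i t = lift (does (i ≟ t))
    where
      lift : ∀ b → (if b then ℤ.+ 1 else ℤ.+ 0) ≡ ℤ.+ (if b then 1 else 0)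
      lift true  = refl
      lift false = refl

  [+a]-[+b]≡[+c]-[+d]⇒a+d≡b+c : ∀ a b c d → ℤ.+ a ℤ.- ℤ.+ b ≡ ℤ.+ c ℤ.- ℤ.+ d → a + d ≡ b + c
  [+a]-[+b]≡[+c]-[+d]⇒a+d≡b+c a b c d eq = ℤ.+-injective (begin
      ℤ.+ (a + d)                                    ≡⟨ ℤ.pos-+ a d ⟩
      ℤ.+ a ℤ.+ ℤ.+ d                                ≡⟨ shift (ℤ.+ a) (ℤ.+ b) (ℤ.+ d) ⟩
      (ℤ.+ a ℤ.- ℤ.+ b) ℤ.+ (ℤ.+ b ℤ.+ ℤ.+ d)        ≡⟨ cong (ℤ._+ (ℤ.+ b ℤ.+ ℤ.+ d)) eq ⟩
      (ℤ.+ c ℤ.- ℤ.+ d) ℤ.+ (ℤ.+ b ℤ.+ ℤ.+ d)        ≡⟨ cancel (ℤ.+ b) (ℤ.+ c) (ℤ.+ d) ⟩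
      ℤ.+ b ℤ.+ ℤ.+ c                                ≡⟨ ℤ.pos-+ b c ⟨
      ℤ.+ (b + c)                                    ∎)
    where
      open ≡-Reasoning
      shift : ∀ a b d → a ℤ.+ d ≡ (a ℤ.- b) ℤ.+ (b ℤ.+ d)
      shift = ℤ-Solver.solve-∀
      cancel : ∀ b c d → (c ℤ.- d) ℤ.+ (b ℤ.+ d) ≡ b ℤ.+ c
      cancel = ℤ-Solver.solve-∀

  transferral-balance : ∀ {d} {i j : Fin d} {v₁ v₂ : Fin d → ℕ} →
    (∀ t → unit i t ℤ.- unit j t ≡ (ℤ.+ v₁ t) ℤ.- (ℤ.+ v₂ t)) → ∀ t → δ i t + v₂ t ≡ δ j t + v₁ t
  transferral-balance {i = i} {j} {v₁} {v₂} transfer t =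
    [+a]-[+b]≡[+c]-[+d]⇒a+d≡b+c (δ i t) (δ j t) (v₁ t) (v₂ t)
      (subst₂ (λ a b → a ℤ.- b ≡ _) (unit≡δ i t) (unit≡δ j t) (transfer t))

  linkingSize : ℕ → ℕ
  linkingSize ℓ = 4 * ℓ ∸ 1

  module LinkingConstruction {n d : ℕ} (G : OrientedGraph n) (P : Fin n → Fin d) (x y : Fin n) where

    open ∪-Solver (∪-idempotentCommutativeMonoid n) using (solve; _⊜_; _⊕_)

    H : Hypergraph n
    H = H₄ G

    A : Subset n
    A = ⁅ x ⁆ ∪ ⁅ y ⁆

    record PartialLinking (k : ℕ) (U : Subset n) : Set where
      field
        pairs      : List (Fin n × Fin n)
        #pairs     : length pairs ≡ k
        x∉U        : x ∉ U
        y∉U        : y ∉ U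
        linkable   : All (λ (p , q) → p ≢ q × P p ≡ P q) pairs
        matchableˣ : MatchableWithout H (U ∪ ⁅ x ⁆) (map proj₁ pairs)
        matchableʸ : MatchableWithout H (U ∪ ⁅ y ⁆) (map proj₂ pairs)

    module _ {X Y : Subset n} (disj : Disjoint (X ∪ A) Y) where

      x∉ : x ∉ Y
      x∉ = disjoint⁻ disj (q⊆p∪q X A (p⊆p∪q ⁅ y ⁆ (x∈⁅x⁆ x)))

      y∉ : y ∉ Y
      y∉ = disjoint⁻ disj (q⊆p∪q X A (q⊆p∪q ⁅ x ⁆ ⁅ y ⁆ (x∈⁅x⁆ y)))

      apartˣ : Disjoint (X ∪ ⁅ x ⁆) Y
      apartˣ = Disjoint-∪ˡ (Disjoint-⊆ˡ (p⊆p∪q A) disj) (x∉p⇒Disjoint⁅x⁆p x∉)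

      apartʸ : Disjoint (X ∪ ⁅ y ⁆) Y
      apartʸ = Disjoint-∪ˡ (Disjoint-⊆ˡ (p⊆p∪q A) disj) (x∉p⇒Disjoint⁅x⁆p y∉)

    ∪-swap : ∀ (X Z Y : Subset n) → (X ∪ Z) ∪ Y ≡ (X ∪ Y) ∪ Z
    ∪-swap = solve 3 (λ X Z Y → (X ⊕ Z) ⊕ Y ⊜ (X ⊕ Y) ⊕ Z) refl

    linkNextPair : ∀ {q s ℓ k X} → (∀ {p p′} → p ≢ p′ → P p ≡ P p′ → Dense q s (Linking 4 H p p′ ℓ)) →
      PartialLinking (suc k) X → Dense q s (λ Y → Disjoint (X ∪ A) Y → PartialLinking k (X ∪ Y))
    linkNextPair reach record { pairs = [] ; #pairs = () }
    linkNextPair {s = s} {ℓ} {k} {X} reach record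
      { pairs = (p , p′) ∷ rest ; #pairs = #pairs ; x∉U = x∉X ; y∉U = y∉X
      ; linkable = (p≢p′ , same) ∷ linkable ; matchableˣ = matchableˣ ; matchableʸ = matchableʸ } =
      Dense-map linkPair (reach p≢p′ same)
      where
        linkPair : ∀ {Y} → ∣ Y ∣ ≡ s → Linking 4 H p p′ ℓ Y → Disjoint (X ∪ A) Y → PartialLinking k (X ∪ Y)
        linkPair {Y} _ (_ , _ , _ , pmᵖ , pmᵖ′) disj = record
          { pairs      = rest
          ; #pairs     = suc-injective #pairs
          ; x∉U        = ∉-∪ x∉X (x∉ disj)
          ; y∉U        = ∉-∪ y∉X (y∉ disj)
          ; linkable   = linkable
          ; matchableˣ = subst (λ T → MatchableWithout H T (map proj₁ rest)) (∪-swap X ⁅ x ⁆ Y)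
                           (matchableWithout-settle H matchableˣ (apartˣ disj) pmᵖ)
          ; matchableʸ = subst (λ T → MatchableWithout H T (map proj₂ rest)) (∪-swap X ⁅ y ⁆ Y)
                           (matchableWithout-settle H matchableʸ (apartʸ disj) pmᵖ′)
          }

    EdgeOfType : (Fin d → ℕ) → Subset n → Set
    EdgeOfType v e = H e × (∀ t → index P e t ≡ v t)

    fromTwoEdges : ∀ {e₁ e₂} → x ≢ y → H e₁ → H e₂ → x ∉ e₁ → y ∉ e₁ → Disjoint (e₁ ∪ A) e₂ →
      (∀ t → labelCount P t (x ∷ elements e₂) ≡ labelCount P t (y ∷ elements e₁)) → PartialLinking 5 (e₁ ∪ e₂)
    fromTwoEdges {e₁} {e₂} x≢y h₁ h₂ x∉e₁ y∉e₁ disj balanced with pairUp P (x ∷ elements e₂) (y ∷ elements e₁) balanced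
    ... | pairs , firsts , seconds↭ , labels = record
      { pairs      = pairs
      ; #pairs     = trans (sym (length-map proj₁ pairs))
                       (trans (cong length firsts) (cong suc (trans (length-elements e₂) (proj₁ h₂))))
      ; x∉U        = ∉-∪ x∉e₁ (x∉ disj)
      ; y∉U        = ∉-∪ y∉e₁ (y∉ disj)
      ; linkable   = All.zip (All.tabulate separated , labels)
      ; matchableˣ = subst (MatchableWithout H _) (sym firsts)
                       (uniqueˣ , e₁ , pm-edge H h₁ ,
                        subst (Disjoint e₁) (sym Dˣ) e₁∩Dˣ=∅ , trans (cong (e₁ ∪_) Dˣ) (regroupˣ e₁ e₂ ⁅ x ⁆))
      ; matchableʸ = Unique-↭ (↭-sym seconds↭) uniqueʸ , e₂ , pm-edge H h₂ ,
                     subst (Disjoint e₂) (sym Dʸ) e₂∩Dʸ=∅ , trans (cong (e₂ ∪_) Dʸ) (regroupʸ e₁ e₂ ⁅ y ⁆)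
      }
      where
        Dˣ : fromList (x ∷ elements e₂) ≡ ⁅ x ⁆ ∪ e₂
        Dˣ = cong (⁅ x ⁆ ∪_) (fromList-elements e₂)
        Dʸ : fromList (map proj₂ pairs) ≡ ⁅ y ⁆ ∪ e₁
        Dʸ = trans (fromList-↭ seconds↭) (cong (⁅ y ⁆ ∪_) (fromList-elements e₁))

        e₁∩e₂=∅ : Disjoint e₁ e₂
        e₁∩e₂=∅ = Disjoint-⊆ˡ (p⊆p∪q A) disj

        e₁∩Dˣ=∅ : Disjoint e₁ (⁅ x ⁆ ∪ e₂)
        e₁∩Dˣ=∅ = Disjoint-∪ʳ (Disjoint-sym (x∉p⇒Disjoint⁅x⁆p x∉e₁)) e₁∩e₂=∅
        e₂∩Dʸ=∅ : Disjoint e₂ (⁅ y ⁆ ∪ e₁)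
        e₂∩Dʸ=∅ = Disjoint-∪ʳ (Disjoint-sym (x∉p⇒Disjoint⁅x⁆p (y∉ disj))) (Disjoint-sym e₁∩e₂=∅)
        Dˣ∩Dʸ=∅ : Disjoint (⁅ x ⁆ ∪ e₂) (⁅ y ⁆ ∪ e₁)
        Dˣ∩Dʸ=∅ = Disjoint-∪ˡ (x∉p⇒Disjoint⁅x⁆p (∉-∪ (x≢y⇒x∉⁅y⁆ x≢y) x∉e₁)) e₂∩Dʸ=∅

        separated : ∀ {pq} → pq ∈ₗ pairs → proj₁ pq ≢ proj₂ pq
        separated {pq} pq∈ p≡q = disjoint⁻ Dˣ∩Dʸ=∅ p∈Dˣ (subst (_∈ ⁅ y ⁆ ∪ e₁) (sym p≡q) q∈Dʸ)
          where
            p∈Dˣ : proj₁ pq ∈ ⁅ x ⁆ ∪ e₂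
            p∈Dˣ = subst (_ ∈_) Dˣ (∈-fromList⁺ (subst (_ ∈ₗ_) firsts (∈-map⁺ proj₁ pq∈)))
            q∈Dʸ : proj₂ pq ∈ ⁅ y ⁆ ∪ e₁
            q∈Dʸ = subst (_ ∈_) Dʸ (∈-fromList⁺ (∈-map⁺ proj₂ pq∈))

        avoids : ∀ {z e} → z ∉ e → All (z ≢_) (elements e)
        avoids {z} {e} z∉e = All.tabulate λ v∈ z≡v → z∉e (subst (_∈ e) (sym z≡v) (∈-elements⁻ v∈))
        uniqueˣ : Unique (x ∷ elements e₂)
        uniqueˣ = avoids (x∉ disj) ∷ elements-unique e₂
        uniqueʸ : Unique (y ∷ elements e₁)
        uniqueʸ = avoids y∉e₁ ∷ elements-unique e₁

        regroupˣ : ∀ e₁ e₂ z → e₁ ∪ (z ∪ e₂) ≡ (e₁ ∪ e₂) ∪ z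
        regroupˣ = solve 3 (λ e₁ e₂ z → e₁ ⊕ (z ⊕ e₂) ⊜ (e₁ ⊕ e₂) ⊕ z) refl
        regroupʸ : ∀ e₁ e₂ z → e₂ ∪ (z ∪ e₁) ≡ (e₁ ∪ e₂) ∪ z
        regroupʸ = solve 3 (λ e₁ e₂ z → e₂ ⊕ (z ⊕ e₁) ⊜ (e₁ ⊕ e₂) ⊕ z) refl

    completed : ∀ {ℓ U} → ∣ U ∣ ≡ linkingSize ℓ → PartialLinking 0 U → Linking 4 H x y ℓ U
    completed size record { pairs = [] ; x∉U = x∉U ; y∉U = y∉U ; matchableˣ = matchableˣ ; matchableʸ = matchableʸ } =
      x∉U , y∉U , size , matchableWithout-[] H matchableˣ , matchableWithout-[] H matchableʸ
    completed _ record { pairs = _ ∷ _ ; #pairs = () }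

    labelCount-balanced : ∀ {v₁ v₂ : Fin d → ℕ} {e₁ e₂} → (∀ t → δ (P x) t + v₂ t ≡ δ (P y) t + v₁ t) →
      (∀ t → index P e₁ t ≡ v₁ t) → (∀ t → index P e₂ t ≡ v₂ t) →
      ∀ t → labelCount P t (x ∷ elements e₂) ≡ labelCount P t (y ∷ elements e₁)
    labelCount-balanced {v₁} {v₂} {e₁} {e₂} balanced idx₁ idx₂ t = begin
        δ (P x) t + labelCount P t (elements e₂)  ≡⟨ cong (δ (P x) t +_) (trans (sym (index-elements P e₂ t)) (idx₂ t)) ⟩
        δ (P x) t + v₂ t                          ≡⟨ balanced t ⟩
        δ (P y) t + v₁ t                          ≡⟨ cong (δ (P y) t +_) (trans (sym (idx₁ t)) (index-elements P e₁ t)) ⟩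
        δ (P y) t + labelCount P t (elements e₁)  ∎
      where open ≡-Reasoning

    module _ {l q : ℕ} (x≢y : x ≢ y) (large : 2 * q * (linkingSize (5 * suc l + 1) + 2) ≤ n)
      (reach : ∀ {p p′} → p ≢ p′ → P p ≡ P p′ → Dense q (linkingSize (suc l)) (Linking 4 H p p′ (suc l))) where

      private
        M m : ℕ
        M = linkingSize (5 * suc l + 1)
        m = 3 + 4 * l

        total-size : 8 + 5 * m ≡ M
        total-size = cong (_∸ 1) (expand l)
          where
            expand : ∀ l → suc (8 + 5 * (3 + 4 * l)) ≡ 4 * (5 * suc l + 1)
            expand = solve-∀

        reach′ : ∀ {p p′} → p ≢ p′ → P p ≡ P p′ → Dense q m (Linking 4 H p p′ (suc l))
        reach′ {p} {p′} p≢p′ same =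
          subst (λ s → Dense q s (Linking 4 H p p′ (suc l))) (cong (_∸ 1) (*-suc 4 l)) (reach p≢p′ same)

        ∣A∣≤2 : ∣ A ∣ ≤ 2
        ∣A∣≤2 = ≤-trans (∣p∪q∣≤∣p∣+∣q∣ ⁅ x ⁆ ⁅ y ⁆) (≤-reflexive (cong₂ _+_ (∣⁅x⁆∣≡1 x) (∣⁅x⁆∣≡1 y)))

      open Growth A q M (≤-trans (*-monoʳ-≤ (2 * q) (+-monoʳ-≤ M ∣A∣≤2)) large)

      linkAllPairs : ∀ k {i s} → s + k * m ≡ M → Dense (growth ^ i) s (PartialLinking k) →
        Dense (growth ^ (k + i)) M (PartialLinking 0)
      linkAllPairs zero {i} {s} s≡M R =
        subst (λ s → Dense (growth ^ i) s (PartialLinking 0)) (trans (sym (+-identityʳ s)) s≡M) R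
      linkAllPairs (suc k) {i} {s} s+km≡M R =
        subst (λ j → Dense (growth ^ j) M (PartialLinking 0)) (+-suc k i)
          (linkAllPairs k {suc i} {s + m} s+m+km≡M (step s+m≤M R (λ _ → linkNextPair {ℓ = suc l} reach′)))
        where
          s+m+km≡M = trans (+-assoc s m (k * m)) s+km≡M
          s+m≤M = ≤-trans (m≤m+n (s + m) (k * m)) (≤-reflexive s+m+km≡M)

      linking-dense : ∀ {v₁ v₂} → Dense q 4 (EdgeOfType v₁) → Dense q 4 (EdgeOfType v₂) →
        (∀ t → δ (P x) t + v₂ t ≡ δ (P y) t + v₁ t) → Dense (growth ^ 7) M (Linking 4 H x y (5 * suc l + 1))
      linking-dense {v₁} {v₂} E₁ E₂ balanced = Dense-map (completed {5 * suc l + 1}) (linkAllPairs 5 {2} {8} total-size R₂)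
        where
          8≤M : 8 ≤ M
          8≤M = ≤-trans (m≤m+n 8 (5 * m)) (≤-reflexive total-size)

          R₀ : Dense 1 0 (_≡ ∅)
          R₀ = dense (∅ ∷ []) ([] ∷ []) ((∣⊥∣≡0 n , refl) ∷ []) ≤-refl

          R₁ : Dense (growth ^ 1) 4 (λ e₁ → EdgeOfType v₁ e₁ × x ∉ e₁ × y ∉ e₁)
          R₁ = step (≤-trans (m≤m+n 4 4) 8≤M) R₀ λ { _ refl → Dense-map (λ {Y} _ edge disj →
                 subst (λ e₁ → EdgeOfType v₁ e₁ × x ∉ e₁ × y ∉ e₁) (sym (∪-identityˡ Y)) (edge , x∉ disj , y∉ disj)) E₁ }

          R₂ : Dense (growth ^ 2) 8 (PartialLinking 5)
          R₂ = step 8≤M R₁ λ {e₁} _ ((h₁ , idx₁) , x∉e₁ , y∉e₁) → Dense-map (λ {e₂} _ (h₂ , idx₂) disj →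
                 fromTwoEdges x≢y h₁ h₂ x∉e₁ y∉e₁ disj (labelCount-balanced {v₁} {v₂} {e₁} {e₂} balanced idx₁ idx₂)) E₂

open import Defs
open import Data.Nat using (ℕ; _≥_; _+_; _*_; NonZero; suc; _^_)
open import Data.Nat.Properties using (m≤m+n; m≤n+m)
open import Data.Integer using (+_)
open import Data.Rational using (ℚ; _<_; _≤_; 0ℚ; _/_; ↧ₙ_)
open import Data.Fin using (Fin)
open import Data.Product using (Σ; _×_; ∃-syntax; _,_; proj₁; proj₂)
open import Data.Sum using (inj₁; inj₂)
open import Function using (_∘_; case_of_)
open import Relation.Binary.PropositionalEquality using (_≡_; _≢_; cong; sym; subst₂)

lemma5p18 : (ℓ d : ℕ) → .{{_ : NonZero ℓ}} → .{{_ : NonZero d}} →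
    (β′ μ₄ : ℚ) → 0ℚ < β′ → β′ ≤ (+ 1) / d → 0ℚ < μ₄ →
    ∃[ β ] (0ℚ < β × ∃[ n₀ ] (∀ (n : ℕ) → n ≥ n₀ →
      (G : OrientedGraph n) → (P : Fin n → Fin d) →
      PartitionClosed 4 (H₄ G) β′ ℓ P →
      (i j : Fin d) → i ≢ j →
      Transferral 4 μ₄ P (H₄ G) i j →
      PartitionClosed 4 (H₄ G) β (5 * ℓ + 1) (merge P i j)))
lemma5p18 ℓ@(suc l) d β′ μ₄ 0<β′ _ 0<μ₄ = (+ 1) / suc K , 0<1/suc K , n₀ , merged-closed
  where
    q M K n₀ : ℕ
    q = ↧ₙ β′ + ↧ₙ μ₄
    M = linkingSize (5 * ℓ + 1)
    K = (2 * q * 2 ^ M) ^ 7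
    n₀ = 2 * q * (M + 2)

    merged-closed : ∀ n → n ≥ n₀ → (G : OrientedGraph n) (P : Fin n → Fin d) → PartitionClosed 4 (H₄ G) β′ ℓ P →
      (i j : Fin d) → i ≢ j → Transferral 4 μ₄ P (H₄ G) i j →
      PartitionClosed 4 (H₄ G) ((+ 1) / suc K) (5 * ℓ + 1) (merge P i j)
    merged-closed n n≥n₀ G P closed i j _ (_ , v₁ , v₂ , I₁ , I₂ , transfer) x y merged x≢y =
      dense⇒atLeast (case merge-cases P x y merged of λ where
        (inj₁ Px≡Py) → linking-dense x≢y n≥n₀ reach (edges I₁) (edges I₁) λ t → cong (λ s → δ s t + v₁ t) Px≡Py
        (inj₂ (inj₁ (Px≡i , Py≡j))) → linking-dense x≢y n≥n₀ reach (edges I₁) (edges I₂) λ t →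
          subst₂ (λ a b → δ a t + v₂ t ≡ δ b t + v₁ t) (sym Px≡i) (sym Py≡j) (balance t)
        (inj₂ (inj₂ (Px≡j , Py≡i))) → linking-dense x≢y n≥n₀ reach (edges I₂) (edges I₁) λ t →
          subst₂ (λ a b → δ a t + v₁ t ≡ δ b t + v₂ t) (sym Px≡j) (sym Py≡i) (sym (balance t)))
      where
        open LinkingConstruction G P x y

        balance : ∀ t → δ i t + v₂ t ≡ δ j t + v₁ t
        balance = transferral-balance {i = i} {j} {v₁} {v₂} transfer

        reach : ∀ {p p′} → p ≢ p′ → P p ≡ P p′ → Dense q (linkingSize ℓ) (Linking 4 H p p′ ℓ)
        reach p≢p′ same =
          Dense-weaken (m≤m+n (↧ₙ β′) (↧ₙ μ₄)) (atLeast⇒dense 0<β′ (closed _ _ same p≢p′) (proj₁ ∘ proj₂ ∘ proj₂))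

        edges : ∀ {v} → InI 4 μ₄ P (H₄ G) v → Dense q 4 (EdgeOfType v)
        edges I = Dense-weaken (m≤n+m (↧ₙ μ₄) (↧ₙ β′)) (atLeast⇒dense 0<μ₄ I (proj₁ ∘ proj₁))
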